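{- Let $G$ be the directed graph with vertex set $\mathbb{N}=\{0,1,2,\ldots\}$ having, for each $i\in\mathbb{N}$, one directed edge $(i,i+1)$ and one loop $(i,i)$. Then for every $n\geq1$, $G$ sorts $\Delta^n$: there is a unique $G$-stable labeled configuration $\mathcal{D}$ with $\Delta^n\xrightarrow{G}\mathcal{D}$, and $\mathcal{D}(i)\leq\mathcal{D}(j)$ for all $1\leq i\leq j\leq n$.
   Context: Every vertex has out-degree $2$. A labeled configuration assigns finitely many chips, labeled by distinct positive integers, to vertices; $\mathcal{C}(i)$ is the vertex of chip $(i)$. $\Delta^n$ has chips $(1),\ldots,(n)$ at vertex $0$. A labeled firing at vertex $v$: choose two chips at $v$; the smaller-labeled one stays at $v$ (travels along the loop) and the larger-labeled one moves to $v+1$. $\mathcal{C}\xrightarrow{G}\mathcal{D}$ means reachable by zero or more such firings; $\mathcal{D}$ is $G$-stable if every vertex holds at most one chip. -}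

module Defs where

open import Data.Nat using (ℕ; suc) renaming (_≤_ to _≤ℕ_)
open import Data.Fin using (Fin; _<_) renaming (_≤_ to _≤F_)
open import Data.Vec using (Vec; lookup; replicate; _[_]≔_)
open import Data.Product using (Σ; _×_; ∃)
open import Relation.Binary.PropositionalEquality using (_≡_)
open import Relation.Binary.Construct.Closure.ReflexiveTransitive using (Star)
open import Relation.Nullary using (¬_)

-- A labeled configuration with chips (1),...,(n): chip (k+1) is represented
-- by index k : Fin n, and  C lookup k  is the vertex (in ℕ) where it sits.
Config : ℕ → Set
Config n = Vec ℕ n

Δ : (n : ℕ) → Config n
Δ n = replicate n 0

-- One labeled firing in G: two chips i < j (by label) at the same vertex v;
-- the smaller label i stays at v (loop), the larger label j moves to v+1.
data Fire {n : ℕ} : Config n → Config n → Set where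
  fire : (C : Config n) (i j : Fin n) → i < j →
         lookup C i ≡ lookup C j →
         Fire C (C [ j ]≔ suc (lookup C j))

_⟶G_ : {n : ℕ} → Config n → Config n → Set
_⟶G_ = Star Fire

Stable : {n : ℕ} → Config n → Set
Stable {n} D = (i j : Fin n) → lookup D i ≡ lookup D j → i ≡ j

Sorts : (n : ℕ) → Set
Sorts n = Σ (Config n) λ D →
            (Δ n ⟶G D) × Stable D ×
            ((D' : Config n) → Δ n ⟶G D' → Stable D' → D' ≡ D) ×
            ((i j : Fin n) → i ≤F j → lookup D i ≤ℕ lookup D j)

-- Chip k (0-indexed) never passes vertex k: chips i < j fire only from a common
-- vertex v ≤ i, so j lands on v + 1 ≤ i + 1 ≤ j.  A stable configuration with
-- this property is the staircase k ↦ k, since by strong induction on k the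
-- vertices below k are already taken by the smaller chips.  Conversely, the
-- staircase is reached by adding chips one at a time, each addition triggering
-- a cascade that shifts the staircase above it up by one vertex.
module Submission where

open import Defs
open import Data.Nat using (ℕ; zero; suc; _+_; _≤_; _<_; _≥_; z≤n; s≤s)
open import Data.Nat.Properties using (+-identityʳ; +-suc; +-cancelˡ-≡; +-monoʳ-≤; <-≤-trans; ≤-<-trans; <⇒≤; <⇒≢; m≤n⇒m<n∨m≡n)
open import Data.Fin as Fin using (Fin; toℕ; fromℕ<)
open import Data.Fin.Properties using (toℕ-injective; toℕ<n; toℕ-fromℕ<)
open import Data.Fin.Induction using (<-wellFounded)
open import Data.Vec using ([]; _∷_; lookup; replicate; tabulate)
open import Data.Vec.Properties
  using (lookup∘update; lookup∘update′; lookup-replicate; tabulate∘lookup; tabulate-cong)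
open import Data.Product using (_,_)
open import Data.Sum using (inj₁; inj₂)
open import Induction.WellFounded using (Acc; acc)
open import Relation.Nullary using (yes; no; contradiction)
open import Relation.Binary.PropositionalEquality
  using (_≡_; refl; sym; trans; cong; subst; module ≡-Reasoning)
open import Relation.Binary.Construct.Closure.ReflexiveTransitive using (ε; _◅_; _◅◅_; gmap)

private
  variable
    n : ℕ

staircase : ℕ → (n : ℕ) → Config n
staircase c zero    = []
staircase c (suc n) = c ∷ staircase (suc c) n

lookup-staircase : ∀ c (k : Fin n) → lookup (staircase c n) k ≡ c + toℕ k
lookup-staircase c Fin.zero    = sym (+-identityʳ c)
lookup-staircase c (Fin.suc k) = trans (lookup-staircase (suc c) k) (sym (+-suc c (toℕ k)))

Fire-∷ : ∀ x {C D : Config n} → Fire C D → Fire (x ∷ C) (x ∷ D)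
Fire-∷ x (fire C i j i<j Ci≡Cj) = fire (x ∷ C) (Fin.suc i) (Fin.suc j) (s≤s i<j) Ci≡Cj

⟶G-∷ : ∀ x {C D : Config n} → C ⟶G D → (x ∷ C) ⟶G (x ∷ D)
⟶G-∷ x = gmap (x ∷_) (Fire-∷ x)

cascade : ∀ c n → (c ∷ staircase c n) ⟶G (c ∷ staircase (suc c) n)
cascade c zero    = ε
cascade c (suc n) =
  fire (c ∷ c ∷ staircase (suc c) n) Fin.zero (Fin.suc Fin.zero) (s≤s z≤n) refl
  ◅ ⟶G-∷ c (cascade (suc c) n)

replicate⟶Gstaircase : ∀ n c → replicate n c ⟶G staircase c n
replicate⟶Gstaircase zero    c = ε
replicate⟶Gstaircase (suc n) c = ⟶G-∷ c (replicate⟶Gstaircase n c) ◅◅ cascade c n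

LabelBounded : Config n → Set
LabelBounded C = ∀ k → lookup C k ≤ toℕ k

Δ-labelBounded : ∀ n → LabelBounded (Δ n)
Δ-labelBounded n k rewrite lookup-replicate k 0 = z≤n

Fire-labelBounded : {C D : Config n} → Fire C D → LabelBounded C → LabelBounded D
Fire-labelBounded (fire C i j i<j Ci≡Cj) bounded k with k Fin.≟ j
... | yes refl rewrite lookup∘update j C (suc (lookup C j)) =
  ≤-<-trans (subst (_≤ toℕ i) Ci≡Cj (bounded i)) i<j
... | no k≢j rewrite lookup∘update′ k≢j C (suc (lookup C j)) = bounded k

⟶G-labelBounded : {C D : Config n} → C ⟶G D → LabelBounded C → LabelBounded D
⟶G-labelBounded ε        bounded = bounded
⟶G-labelBounded (f ◅ fs) bounded = ⟶G-labelBounded fs (Fire-labelBounded f bounded)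

stable∧labelBounded⇒lookup≡toℕ : (D : Config n) → Stable D → LabelBounded D →
                                 ∀ k → lookup D k ≡ toℕ k
stable∧labelBounded⇒lookup≡toℕ {n} D stable bounded k = go k (<-wellFounded k)
  where
  go : ∀ k → Acc Fin._<_ k → lookup D k ≡ toℕ k
  go k (acc smaller) with m≤n⇒m<n∨m≡n (bounded k)
  ... | inj₂ Dk≡k = Dk≡k
  ... | inj₁ Dk<k = contradiction (cong toℕ (stable i k Di≡Dk)) (<⇒≢ i<k)
    where
    Dk<n : lookup D k < n
    Dk<n = <-≤-trans Dk<k (<⇒≤ (toℕ<n k))
    i : Fin n
    i = fromℕ< Dk<n
    toℕi≡Dk : toℕ i ≡ lookup D k
    toℕi≡Dk = toℕ-fromℕ< Dk<n
    i<k : i Fin.< k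
    i<k = subst (_< toℕ k) (sym toℕi≡Dk) Dk<k
    Di≡Dk : lookup D i ≡ lookup D k
    Di≡Dk = trans (go i (smaller i<k)) toℕi≡Dk

staircase-stable : ∀ c → Stable (staircase c n)
staircase-stable c i j Ci≡Cj = toℕ-injective (+-cancelˡ-≡ c _ _ (begin
  c + toℕ i                 ≡⟨ sym (lookup-staircase c i) ⟩
  lookup (staircase c _) i  ≡⟨ Ci≡Cj ⟩
  lookup (staircase c _) j  ≡⟨ lookup-staircase c j ⟩
  c + toℕ j                 ∎))
  where open ≡-Reasoning

Δ⟶G-stable⇒staircase : (D : Config n) → Δ n ⟶G D → Stable D → D ≡ staircase 0 n
Δ⟶G-stable⇒staircase {n} D Δ⟶D stable = begin
  D                                  ≡⟨ sym (tabulate∘lookup D) ⟩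
  tabulate (lookup D)                ≡⟨ tabulate-cong lookupD≡staircase ⟩
  tabulate (lookup (staircase 0 n))  ≡⟨ tabulate∘lookup (staircase 0 n) ⟩
  staircase 0 n                      ∎
  where
  open ≡-Reasoning
  bounded : LabelBounded D
  bounded = ⟶G-labelBounded Δ⟶D (Δ-labelBounded n)
  lookupD≡staircase : ∀ k → lookup D k ≡ lookup (staircase 0 n) k
  lookupD≡staircase k =
    trans (stable∧labelBounded⇒lookup≡toℕ D stable bounded k) (sym (lookup-staircase 0 k))

staircase-monotone : ∀ c (i j : Fin n) → i Fin.≤ j → lookup (staircase c n) i ≤ lookup (staircase c n) j
staircase-monotone c i j i≤j rewrite lookup-staircase c i | lookup-staircase c j = +-monoʳ-≤ c i≤j

proposition3p2 : (n : ℕ) → n ≥ 1 → Sorts n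
proposition3p2 n _ =
  staircase 0 n , replicate⟶Gstaircase n 0 , staircase-stable 0 ,
  Δ⟶G-stable⇒staircase , staircase-monotone 0
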